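{- (i) Let $k,d\in\mathbb{N}$, let $b,A_1,\ldots,A_k,N_1,\ldots,N_k\in\mathbb{N}$ with $\gcd(A_1,\ldots,A_k)=1$, and let $\mathcal{P}=\{b+A_1n_1+\cdots+A_kn_k:n_i\in\mathbb{Z},\ |n_i|\le N_i\}$. Then \[\frac{\#\{n\in\mathcal{P}:d\mid n\}}{N_1\cdots N_k}\ll_k d^{ -1}+\big(\min_{i\le k}N_i\big)^{ -1}.\] (ii) Let $k,d\in\mathbb{N}$, let $b,A_1,\ldots,A_k,N_1,\ldots,N_k\in\mathbb{N}$ with $\gcd(A_1,\ldots,A_k)=1$, and let $\mathcal{P}^+=\{b+A_1n_1+\cdots+A_kn_k:n_i\in\mathbb{Z},\ 1\le n_i\le N_i\}$ be proper. Then \[\frac{\#\{n\in\mathcal{P}^+:d\mid n\}}{N_1\cdots N_k}=d^{ -1}+O_k\big(1/\min_{i\le k}N_i\big).\]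
   Context: $\mathcal{P}^+$ is proper if every $n\in\mathcal{P}^+$ has a unique representation $n=b+A_1n_1+\cdots+A_kn_k$ with $1\le n_i\le N_i$ for all $i$. -}

module Defs where

open import Data.Nat as ℕ using (ℕ; zero; suc; _⊓_; _≤_)
open import Data.Nat.GCD using (gcd)
open import Data.Integer as ℤ using (ℤ; +_; -_)
import Data.Integer.Properties as ℤP
open import Data.Integer.Divisibility using () renaming (_∣_ to _∣ℤ_)
import Data.Nat.Divisibility as ℕD
open import Data.List as L using (List; []; _∷_; filter; deduplicate; length; map; concatMap; upTo)
open import Data.Vec as V using (Vec; []; _∷_; lookup)
open import Data.Fin using (Fin)
open import Relation.Nullary using (Dec)

intRange : ℤ → ℕ → List ℤ
intRange a len = map (λ j → a ℤ.+ + j) (upTo len)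

symRange : ℕ → List ℤ
symRange N = intRange (- (+ N)) (suc (N ℕ.+ N))

posRange : ℕ → List ℤ
posRange N = intRange (+ 1) N

box : ∀ {k} → Vec (List ℤ) k → List (Vec ℤ k)
box [] = [] ∷ []
box (r ∷ rs) = concatMap (λ x → map (x ∷_) (box rs)) r

linVal : ∀ {k} → ℕ → Vec ℕ k → Vec ℤ k → ℤ
linVal b [] [] = + b
linVal b (a ∷ as) (x ∷ xs) = (+ a) ℤ.* x ℤ.+ linVal b as xs

gcdV : ∀ {k} → Vec ℕ k → ℕ
gcdV = V.foldr _ gcd 0

prodV : ∀ {k} → Vec ℕ k → ℕ
prodV = V.foldr _ ℕ._*_ 1

-- min_{i ≤ k} N_i  (only used for k ≥ 1)
minV : ∀ {k} → Vec ℕ k → ℕ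
minV [] = 0
minV (x ∷ []) = x
minV (x ∷ y ∷ xs) = x ⊓ minV (y ∷ xs)

Pset : ∀ {k} → ℕ → Vec ℕ k → Vec ℕ k → List ℤ
Pset b A N = deduplicate ℤ._≟_ (map (linVal b A) (box (V.map symRange N)))

P⁺set : ∀ {k} → ℕ → Vec ℕ k → Vec ℕ k → List ℤ
P⁺set b A N = deduplicate ℤ._≟_ (map (linVal b A) (box (V.map posRange N)))

_∣?ℤ_ : (d : ℕ) (n : ℤ) → Dec ((+ d) ∣ℤ n)
d ∣?ℤ n = d ℕD.∣? ℤ.∣ n ∣

countDiv : ℕ → List ℤ → ℕ
countDiv d S = length (filter (d ∣?ℤ_) S)

InPosBox : ∀ {k} → Vec ℕ k → Vec ℤ k → Set
InPosBox {k} N x = ∀ (i : Fin k) → (+ 1 ℤ.≤ lookup x i) × (lookup x i ℤ.≤ + lookup N i)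
  where open import Data.Product using (_×_)

Proper⁺ : ∀ {k} → ℕ → Vec ℕ k → Vec ℕ k → Set
Proper⁺ {k} b A N = ∀ (x y : Vec ℤ k) → InPosBox N x → InPosBox N y →
                    linVal b A x ≡ linVal b A y → x ≡ y
  where open import Relation.Binary.PropositionalEquality using (_≡_)

module Submission where

-- Put e = d / gcd(d, A₁, …, A_k) and count the points n of a box of side lengths L₁, …, L_k for which
-- d ∣ c + b + Σ Aᵢ nᵢ, one coordinate at a time.  Once n₁ is fixed, the remaining count vanishes unless
-- gcd(d, A₂, …, A_k) divides the constant term; after dividing out gcd(d, A₁, …, A_k), this condition on n₁ is
-- a linear congruence modulo some ρ coprime to A₁, hence it singles out one residue class and holds for
-- L₁/ρ + O(1) values of n₁.  Induction on k gives  count = (∏ Lᵢ)/e + O(k (∏ Lᵢ)/min Lᵢ).  When gcd(A) = 1 we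
-- have e = d; P is covered by the box of side lengths 2Nᵢ + 1, and since P⁺ is proper its elements are in
-- bijection with the points of its box.

open import Data.List as List using (List; []; _∷_; map; upTo)
open import Data.List.Relation.Unary.AllPairs using ([]; _∷_)
open import Data.List.Relation.Unary.Unique.Propositional using (Unique)
open import Data.Nat.Coprimality using (Coprime; coprime-Bézout)
open import Data.Nat.GCD using (module Bézout)
open import Data.Product using (Σ; ∃; _×_; _,_; proj₁; proj₂; map₂)
open import Function using (_⇔_; mk⇔; Equivalence; it)
open import Function.Construct.Composition using (_⇔-∘_)
open import Relation.Binary.PropositionalEquality
open import Relation.Binary.PropositionalEquality.Properties using (setoid)
import Data.Nat as ℕ
open ℕ using (zero; suc)

open import Defs

module _ where
  open import Data.Nat using (ℕ; _+_; _*_; _≤_; _<_; _⊔_; z≤n; s≤s; NonZero; ∣_-_∣)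
  open import Data.Nat.Properties
  open import Data.Nat.DivMod
  open import Data.Nat.Divisibility using (_∣?_; n∣m⇒m%n≡0; m%n≡0⇒n∣m)
  open import Data.Nat.Tactic.RingSolver using (solve-∀)
  open import Data.List.Properties using (filter-all; upTo-∷ʳ; length-upTo)
  open import Relation.Nullary using (Dec; yes; no; ¬?; contradiction)

  ∑ : {A : Set} → (A → ℕ) → List A → ℕ
  ∑ f []       = 0
  ∑ f (x ∷ xs) = f x + ∑ f xs

  module _ {A : Set} where

    ∑-cong : {f g : A → ℕ} → (∀ x → f x ≡ g x) → ∀ xs → ∑ f xs ≡ ∑ g xs
    ∑-cong f≡g []       = refl
    ∑-cong f≡g (x ∷ xs) = cong₂ _+_ (f≡g x) (∑-cong f≡g xs)

    ∑-mono : {f g : A → ℕ} → (∀ x → f x ≤ g x) → ∀ xs → ∑ f xs ≤ ∑ g xs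
    ∑-mono f≤g []       = z≤n
    ∑-mono f≤g (x ∷ xs) = +-mono-≤ (f≤g x) (∑-mono f≤g xs)

    ∑-zero : {f : A → ℕ} → (∀ x → f x ≡ 0) → ∀ xs → ∑ f xs ≡ 0
    ∑-zero f≡0 []       = refl
    ∑-zero f≡0 (x ∷ xs) = cong₂ _+_ (f≡0 x) (∑-zero f≡0 xs)

    ∑≤length : {f : A → ℕ} → (∀ x → f x ≤ 1) → ∀ xs → ∑ f xs ≤ List.length xs
    ∑≤length f≤1 []       = z≤n
    ∑≤length f≤1 (x ∷ xs) = +-mono-≤ (f≤1 x) (∑≤length f≤1 xs)

    ∑-*ʳ : ∀ (f : A → ℕ) n xs → ∑ f xs * n ≡ ∑ (λ x → f x * n) xs
    ∑-*ʳ f n []       = refl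
    ∑-*ʳ f n (x ∷ xs) = trans (*-distribʳ-+ n (f x) (∑ f xs)) (cong (f x * n +_) (∑-*ʳ f n xs))

    ∑-++ : ∀ (f : A → ℕ) xs ys → ∑ f (xs List.++ ys) ≡ ∑ f xs + ∑ f ys
    ∑-++ f []       ys = refl
    ∑-++ f (x ∷ xs) ys = trans (cong (f x +_) (∑-++ f xs ys)) (sym (+-assoc (f x) _ _))

    ∣∑-∑∣≤∑∣-∣ : ∀ (f g : A → ℕ) xs → ∣ ∑ f xs - ∑ g xs ∣ ≤ ∑ (λ x → ∣ f x - g x ∣) xs
    ∣∑-∑∣≤∑∣-∣ f g []       = z≤n
    ∣∑-∑∣≤∑∣-∣ f g (x ∷ xs) = begin
      ∣ f x + ∑ f xs - g x + ∑ g xs ∣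
        ≤⟨ ∣-∣-triangle (f x + ∑ f xs) (g x + ∑ f xs) (g x + ∑ g xs) ⟩
      ∣ f x + ∑ f xs - g x + ∑ f xs ∣ + ∣ g x + ∑ f xs - g x + ∑ g xs ∣
        ≡⟨ cong₂ _+_ (∣m+o-n+o∣≡∣m-n∣ (f x) (g x) (∑ f xs)) (∣m+n-m+o∣≡∣n-o∣ (g x) _ _) ⟩
      ∣ f x - g x ∣ + ∣ ∑ f xs - ∑ g xs ∣
        ≤⟨ +-monoʳ-≤ ∣ f x - g x ∣ (∣∑-∑∣≤∑∣-∣ f g xs) ⟩
      ∣ f x - g x ∣ + ∑ (λ x → ∣ f x - g x ∣) xs
        ∎
      where
      open ≤-Reasoning
      ∣m+o-n+o∣≡∣m-n∣ : ∀ m n o → ∣ m + o - n + o ∣ ≡ ∣ m - n ∣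
      ∣m+o-n+o∣≡∣m-n∣ m n o = trans (cong₂ ∣_-_∣ (+-comm m o) (+-comm n o)) (∣m+n-m+o∣≡∣n-o∣ o m n)

    ∣∑*-∑*∣≤∑* : ∀ (f g : A → ℕ) a b c → (∀ x → ∣ f x * a - g x * b ∣ ≤ g x * c) →
      ∀ xs → ∣ ∑ f xs * a - ∑ g xs * b ∣ ≤ ∑ g xs * c
    ∣∑*-∑*∣≤∑* f g a b c bound xs = begin
      ∣ ∑ f xs * a - ∑ g xs * b ∣                      ≡⟨ cong₂ ∣_-_∣ (∑-*ʳ f a xs) (∑-*ʳ g b xs) ⟩
      ∣ ∑ (λ x → f x * a) xs - ∑ (λ x → g x * b) xs ∣  ≤⟨ ∣∑-∑∣≤∑∣-∣ _ _ xs ⟩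
      ∑ (λ x → ∣ f x * a - g x * b ∣) xs               ≤⟨ ∑-mono bound xs ⟩
      ∑ (λ x → g x * c) xs                             ≡⟨ ∑-*ʳ g c xs ⟨
      ∑ g xs * c                                       ∎
      where open ≤-Reasoning

  module _ {A B : Set} where

    ∑-map : ∀ (f : B → ℕ) (g : A → B) xs → ∑ f (map g xs) ≡ ∑ (λ x → f (g x)) xs
    ∑-map f g []       = refl
    ∑-map f g (x ∷ xs) = cong (f (g x) +_) (∑-map f g xs)

    ∑-concatMap : ∀ (f : B → ℕ) (g : A → List B) xs → ∑ f (List.concatMap g xs) ≡ ∑ (λ x → ∑ f (g x)) xs
    ∑-concatMap f g []       = refl
    ∑-concatMap f g (x ∷ xs) = trans (∑-++ f (g x) (List.concatMap g xs)) (cong (∑ f (g x) +_) (∑-concatMap f g xs))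

  𝟙 : ∀ {p} {P : Set p} → Dec P → ℕ
  𝟙 (yes _) = 1
  𝟙 (no _)  = 0

  𝟙≤1 : ∀ {p} {P : Set p} (P? : Dec P) → 𝟙 P? ≤ 1
  𝟙≤1 (yes _) = s≤s z≤n
  𝟙≤1 (no _)  = z≤n

  𝟙-cong : ∀ {p q} {P : Set p} {Q : Set q} (P? : Dec P) (Q? : Dec Q) → (P → Q) → (Q → P) → 𝟙 P? ≡ 𝟙 Q?
  𝟙-cong (yes _) (yes _) _   _   = refl
  𝟙-cong (yes p) (no ¬q) P⇒Q _   = contradiction (P⇒Q p) ¬q
  𝟙-cong (no ¬p) (yes q) _   Q⇒P = contradiction (Q⇒P q) ¬p
  𝟙-cong (no _)  (no _)  _   _   = refl

  𝟙-yes : ∀ {p} {P : Set p} (P? : Dec P) → P → 𝟙 P? ≡ 1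
  𝟙-yes (yes _) _ = refl
  𝟙-yes (no ¬p) p = contradiction p ¬p

  module _ {A : Set} {P : A → Set} (P? : ∀ x → Dec (P x)) where

    length-filter≡∑𝟙 : ∀ xs → List.length (List.filter P? xs) ≡ ∑ (λ x → 𝟙 (P? x)) xs
    length-filter≡∑𝟙 []       = refl
    length-filter≡∑𝟙 (x ∷ xs) with P? x
    ... | yes _ = cong suc (length-filter≡∑𝟙 xs)
    ... | no _  = length-filter≡∑𝟙 xs

    ∑-filter≤ : ∀ (f : A → ℕ) xs → ∑ f (List.filter P? xs) ≤ ∑ f xs
    ∑-filter≤ f []       = z≤n
    ∑-filter≤ f (x ∷ xs) with P? x
    ... | yes _ = +-monoʳ-≤ (f x) (∑-filter≤ f xs)
    ... | no _  = ≤-trans (∑-filter≤ f xs) (m≤n+m _ (f x))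

  module _ {A : Set} (_≟_ : (x y : A) → Dec (x ≡ y)) where

    ∑-deduplicate≤ : ∀ (f : A → ℕ) xs → ∑ f (List.deduplicate _≟_ xs) ≤ ∑ f xs
    ∑-deduplicate≤ f []       = z≤n
    ∑-deduplicate≤ f (x ∷ xs) = +-monoʳ-≤ (f x)
      (≤-trans (∑-filter≤ (λ y → ¬? (x ≟ y)) f (List.deduplicate _≟_ xs)) (∑-deduplicate≤ f xs))

    deduplicate-unique : ∀ {xs} → Unique xs → List.deduplicate _≟_ xs ≡ xs
    deduplicate-unique {[]}     []          = refl
    deduplicate-unique {x ∷ xs} (x∉ ∷ uniq) =
      cong (x ∷_) (trans (cong (List.filter _) (deduplicate-unique uniq)) (filter-all (λ y → ¬? (x ≟ y)) x∉))

  ∑-upTo-suc : ∀ (f : ℕ → ℕ) n → ∑ f (upTo (suc n)) ≡ ∑ f (upTo n) + f n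
  ∑-upTo-suc f n = begin
    ∑ f (upTo (suc n))            ≡⟨ cong (∑ f) (upTo-∷ʳ n) ⟨
    ∑ f (upTo n List.∷ʳ n)        ≡⟨ ∑-++ f (upTo n) (n ∷ []) ⟩
    ∑ f (upTo n) + (f n + 0)      ≡⟨ cong (∑ f (upTo n) +_) (+-identityʳ (f n)) ⟩
    ∑ f (upTo n) + f n            ∎
    where open ≡-Reasoning

  multiples : ℕ → ℕ → ℕ → ℕ
  multiples ρ t L = ∑ (λ j → 𝟙 (ρ ∣? t + j)) (upTo L)

  𝟙-∣-step : ∀ r n → 𝟙 (suc r ∣? n) * suc r + n % suc r ≡ suc ((n + r) % suc r)
  𝟙-∣-step r n with suc r ∣? n
  ... | yes ρ∣n = begin
    1 * suc r + n % suc r   ≡⟨ cong (1 * suc r +_) (n∣m⇒m%n≡0 n (suc r) ρ∣n) ⟩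
    1 * suc r + 0           ≡⟨ +-identityʳ (1 * suc r) ⟩
    1 * suc r               ≡⟨ *-identityˡ (suc r) ⟩
    suc r                   ≡⟨ cong suc (m<n⇒m%n≡m (n<1+n r)) ⟨
    suc (r % suc r)         ≡⟨ cong suc (%-remove-+ˡ r ρ∣n) ⟨
    suc ((n + r) % suc r)   ∎
    where open ≡-Reasoning
  ... | no ρ∤n with n % suc r in n%ρ≡
  ...   | zero  = contradiction (m%n≡0⇒n∣m n (suc r) n%ρ≡) ρ∤n
  ...   | suc w = cong suc (sym (begin
    (n + r) % suc r                              ≡⟨ %-congˡ (cong (_+ r) (m≡m%n+[m/n]*n n (suc r))) ⟩
    (n % suc r + n / suc r * suc r + r) % suc r  ≡⟨ %-congˡ (cong (λ x → x + n / suc r * suc r + r) n%ρ≡) ⟩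
    (suc w + n / suc r * suc r + r) % suc r      ≡⟨ %-congˡ (regroup w (n / suc r) r) ⟩
    (w + suc (n / suc r) * suc r) % suc r        ≡⟨ [m+kn]%n≡m%n w (suc (n / suc r)) (suc r) ⟩
    w % suc r                                    ≡⟨ m<n⇒m%n≡m w<ρ ⟩
    w                                            ∎))
    where
    open ≡-Reasoning
    w<ρ : w < suc r
    w<ρ = subst (_≤ suc r) n%ρ≡ (m%n≤n n (suc r))
    regroup : ∀ w q r → suc w + q * suc r + r ≡ w + suc q * suc r
    regroup = solve-∀

  -- The division-free form of  multiples ρ t L ≡ ⌊(t + L + r) / ρ⌋ ∸ ⌊(t + r) / ρ⌋  for ρ = r + 1
  multiples-invariant : ∀ r t L → multiples (suc r) t L * suc r + (t + L + r) % suc r ≡ L + (t + r) % suc r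
  multiples-invariant r t zero    = cong (λ x → (x + r) % suc r) (+-identityʳ t)
  multiples-invariant r t (suc L) = begin
    M (suc L) * suc r + (t + suc L + r) % suc r
      ≡⟨ cong₂ (λ x y → x * suc r + y % suc r) (∑-upTo-suc _ L) (shift t L r) ⟩
    (M L + 𝟙 (suc r ∣? t + L)) * suc r + (t + L + suc r) % suc r
      ≡⟨ cong ((M L + 𝟙 (suc r ∣? t + L)) * suc r +_) ([m+n]%n≡m%n (t + L) (suc r)) ⟩
    (M L + 𝟙 (suc r ∣? t + L)) * suc r + (t + L) % suc r
      ≡⟨ cong (_+ (t + L) % suc r) (*-distribʳ-+ (suc r) (M L) _) ⟩
    M L * suc r + 𝟙 (suc r ∣? t + L) * suc r + (t + L) % suc r
      ≡⟨ +-assoc (M L * suc r) _ _ ⟩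
    M L * suc r + (𝟙 (suc r ∣? t + L) * suc r + (t + L) % suc r)
      ≡⟨ cong (M L * suc r +_) (𝟙-∣-step r (t + L)) ⟩
    M L * suc r + suc ((t + L + r) % suc r)
      ≡⟨ +-suc (M L * suc r) _ ⟩
    suc (M L * suc r + (t + L + r) % suc r)
      ≡⟨ cong suc (multiples-invariant r t L) ⟩
    suc (L + (t + r) % suc r)
      ∎
    where
    open ≡-Reasoning
    M = multiples (suc r) t
    shift : ∀ t L r → t + suc L + r ≡ t + L + suc r
    shift = solve-∀

  m+x≡n+y⇒∣m-n∣≤o : ∀ {m n x y o} → m + x ≡ n + y → x ≤ o → y ≤ o → ∣ m - n ∣ ≤ o
  m+x≡n+y⇒∣m-n∣≤o {m} {n} {x} {y} {o} m+x≡n+y x≤o y≤o = begin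
    ∣ m - n ∣           ≡⟨ ∣m+n-m+o∣≡∣n-o∣ x m n ⟨
    ∣ x + m - x + n ∣   ≡⟨ cong₂ ∣_-_∣ (trans (+-comm x m) m+x≡n+y) (+-comm x n) ⟩
    ∣ n + y - n + x ∣   ≡⟨ ∣m+n-m+o∣≡∣n-o∣ n y x ⟩
    ∣ y - x ∣           ≤⟨ ∣m-n∣≤m⊔n y x ⟩
    y ⊔ x               ≤⟨ ⊔-lub y≤o x≤o ⟩
    o                   ∎
    where open ≤-Reasoning

  ∣multiples*ρ-L∣≤ρ : ∀ ρ .{{_ : NonZero ρ}} t L → ∣ multiples ρ t L * ρ - L ∣ ≤ ρ
  ∣multiples*ρ-L∣≤ρ (suc r) t L =
    m+x≡n+y⇒∣m-n∣≤o (multiples-invariant r t L) (m%n≤n (t + L + r) (suc r)) (m%n≤n (t + r) (suc r))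

  multiples≤L : ∀ ρ t L → multiples ρ t L ≤ L
  multiples≤L ρ t L = subst (multiples ρ t L ≤_) (length-upTo L) (∑≤length (λ j → 𝟙≤1 (ρ ∣? t + j)) (upTo L))

  m*n≡o*[p*m]⇒n≡p*o : ∀ m {n o p} .{{_ : NonZero m}} → m * n ≡ o * (p * m) → n ≡ p * o
  m*n≡o*[p*m]⇒n≡p*o m {n} {o} {p} eq = *-cancelˡ-≡ n (p * o) m (trans eq (regroup o p m))
    where
    regroup : ∀ o p m → o * (p * m) ≡ m * (p * o)
    regroup = solve-∀

module _ where
  open import Data.Integer using (+_; -_; _+_; _*_; _-_; _⊖_; _%ℕ_; _/ℕ_)
  import Data.Integer
  open import Data.Integer.Properties
    using (pos-+; pos-*; m-n≡m⊖n; [1+m]⊖[1+n]≡m⊖n; +-injective; +-assoc; *-comm; *-distribˡ-+)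
  open import Data.Integer.DivMod using (a≡a%ℕn+[a/ℕn]*n)
  open import Data.Integer.Divisibility using () renaming (_∣_ to _∣ᵤ_)
  open import Data.Integer.Divisibility.Signed
  open import Data.Integer.Tactic.RingSolver using (solve-∀)
  open ≡-Reasoning

  private
    pos-1+m*n : ∀ l m n o → 1 ℕ.+ l ℕ.* m ≡ n ℕ.* o → (+ 1) + + l * + m ≡ + n * + o
    pos-1+m*n l m n o eq =
      trans (cong (_+_ (+ 1)) (sym (pos-* l m))) (trans (cong +_ eq) (pos-* n o))

  coprime⇒inverse : ∀ {a ρ} → Coprime a ρ → ∃ λ u → + ρ ∣ + a * u - + 1
  coprime⇒inverse {a} {ρ} cop with coprime-Bézout cop
  ... | Bézout.+- x y eq = + x , divides (+ y) (begin
    + a * + x - + 1           ≡⟨ shape (+ a) (+ x) ⟩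
    + x * + a - + 1           ≡⟨ cong (_- + 1) (pos-1+m*n y ρ x a eq) ⟨
    (+ 1) + + y * + ρ - + 1   ≡⟨ cancel (+ y * + ρ) ⟩
    + y * + ρ                 ∎)
    where
    shape : ∀ a x → a * x - + 1 ≡ x * a - + 1
    shape = solve-∀
    cancel : ∀ z → (+ 1) + z - + 1 ≡ z
    cancel = solve-∀
  ... | Bézout.-+ x y eq = - + x , divides (- + y) (begin
    + a * - + x - + 1         ≡⟨ shape (+ a) (+ x) ⟩
    - ((+ 1) + + x * + a)     ≡⟨ cong -_ (pos-1+m*n x a y ρ eq) ⟩
    - (+ y * + ρ)             ≡⟨ neg (+ y) (+ ρ) ⟩
    - + y * + ρ               ∎)
    where
    shape : ∀ a x → a * - x - + 1 ≡ - ((+ 1) + x * a)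
    shape = solve-∀
    neg : ∀ y ρ → - (y * ρ) ≡ - y * ρ
    neg = solve-∀

  coprime-progression : ∀ {a ρ} .{{_ : ℕ.NonZero ρ}} → Coprime a ρ → ∀ c →
    ∃ λ t → ∀ j → (+ ρ ∣ c + + a * + j) ⇔ (+ ρ ∣ + (t ℕ.+ j))
  -- If a u ≡ 1 (mod ρ), then ρ ∣ c + a j  iff  ρ ∣ u c + j.
  coprime-progression {a} {ρ} cop c with coprime⇒inverse cop
  ... | u , ρ∣au-1 = t , λ j → mk⇔ (forward j) (backward j)
    where
    t = (u * c) %ℕ ρ
    q = (u * c) /ℕ ρ
    ρ∣qρ : + ρ ∣ q * + ρ
    ρ∣qρ = ∣n⇒∣m*n q ∣-refl
    uc+j≡t+j+qρ : ∀ j → u * c + + j ≡ + (t ℕ.+ j) + q * + ρ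
    uc+j≡t+j+qρ j = begin
      u * c + + j               ≡⟨ cong (_+ + j) (a≡a%ℕn+[a/ℕn]*n (u * c) ρ) ⟩
      + t + q * + ρ + + j       ≡⟨ shuffle (+ t) (q * + ρ) (+ j) ⟩
      + t + + j + q * + ρ       ≡⟨ cong (_+ q * + ρ) (pos-+ t j) ⟨
      + (t ℕ.+ j) + q * + ρ     ∎
      where
      shuffle : ∀ x y z → x + y + z ≡ x + z + y
      shuffle = solve-∀
    forward : ∀ j → + ρ ∣ c + + a * + j → + ρ ∣ + (t ℕ.+ j)
    forward j ρ∣c+aj = ∣m+n∣n⇒∣m (subst (+ ρ ∣_) (trans (identity u c (+ a) (+ j)) (uc+j≡t+j+qρ j))
        (∣m∣n⇒∣m-n (∣n⇒∣m*n u ρ∣c+aj) (∣n⇒∣m*n (+ j) ρ∣au-1))) ρ∣qρ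
      where
      identity : ∀ u c a j → u * (c + a * j) - j * (a * u - + 1) ≡ u * c + j
      identity = solve-∀
    backward : ∀ j → + ρ ∣ + (t ℕ.+ j) → + ρ ∣ c + + a * + j
    backward j ρ∣t+j = subst (+ ρ ∣_) (identity u c (+ a) (+ j))
        (∣m∣n⇒∣m-n (∣n⇒∣m*n (+ a) ρ∣uc+j) (∣n⇒∣m*n c ρ∣au-1))
      where
      identity : ∀ u c a j → a * (u * c + j) - c * (a * u - + 1) ≡ c + a * j
      identity = solve-∀
      ρ∣uc+j : + ρ ∣ u * c + + j
      ρ∣uc+j = subst (+ ρ ∣_) (sym (uc+j≡t+j+qρ j)) (∣m∣n⇒∣m+n ρ∣t+j ρ∣qρ)

  private
    expand : ∀ a h c b c′ s j → c + + b ≡ c′ * + h →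
      c + + (a ℕ.* h) * (s + + j) + + b ≡ + h * (c′ + + a * s + + a * + j)
    expand a h c b c′ s j c+b≡c′h = begin
      c + + (a ℕ.* h) * (s + + j) + + b    ≡⟨ cong (λ z → c + z * (s + + j) + + b) (pos-* a h) ⟩
      c + + a * + h * (s + + j) + + b      ≡⟨ swap c (+ a * + h * (s + + j)) (+ b) ⟩
      (c + + b) + + a * + h * (s + + j)    ≡⟨ cong (_+ + a * + h * (s + + j)) c+b≡c′h ⟩
      c′ * + h + + a * + h * (s + + j)     ≡⟨ factor c′ (+ a) (+ h) (s + + j) ⟩
      + h * (c′ + + a * (s + + j))         ≡⟨ cong (λ z → + h * (c′ + z)) (*-distribˡ-+ (+ a) s (+ j)) ⟩
      + h * (c′ + (+ a * s + + a * + j))   ≡⟨ cong (+ h *_) (+-assoc c′ (+ a * s) (+ a * + j)) ⟨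
      + h * (c′ + + a * s + + a * + j)     ∎
      where
      swap : ∀ x y z → x + y + z ≡ x + z + y
      swap = solve-∀
      factor : ∀ c′ a h y → c′ * h + a * h * y ≡ h * (c′ + a * y)
      factor = solve-∀

    +[m*n]≡+n*+m : ∀ m n → + (m ℕ.* n) ≡ + n * + m
    +[m*n]≡+n*+m m n = trans (pos-* m n) (*-comm (+ m) (+ n))

    *-cancelˡ-∣⇔ : ∀ {ρ h x y} .{{_ : ℕ.NonZero h}} → x ≡ + h * y → (+ (ρ ℕ.* h) ∣ x) ⇔ (+ ρ ∣ y)
    *-cancelˡ-∣⇔ {ρ} {h} x≡hy = mk⇔
      (λ ρh∣x → *-cancelˡ-∣ (+ h) (subst₂ _∣_ (+[m*n]≡+n*+m ρ h) x≡hy ρh∣x))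
      (λ ρ∣y → subst₂ _∣_ (sym (+[m*n]≡+n*+m ρ h)) (sym x≡hy) (*-monoʳ-∣ (+ h) ρ∣y))

  progression-divisibility : ∀ {ρ h a} .{{_ : ℕ.NonZero ρ}} .{{_ : ℕ.NonZero h}} → Coprime a ρ →
    ∀ {c b} → + h ∣ c + + b → ∀ s → ∃ λ t → ∀ j →
    (+ (ρ ℕ.* h) ∣ c + + (a ℕ.* h) * (s + + j) + + b) ⇔ (+ ρ ∣ + (t ℕ.+ j))
  progression-divisibility {ρ} {h} {a} cop {c} {b} (divides c′ c+b≡c′h) s =
    map₂ (λ divisibility⇔ j → divisibility⇔ j ⇔-∘ *-cancelˡ-∣⇔ {ρ} (expand a h c b c′ s j c+b≡c′h))
         (coprime-progression cop (c′ + + a * s))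

  ∣m⊖n∣≡∣m-n∣ : ∀ m n → Data.Integer.∣ m ⊖ n ∣ ≡ ℕ.∣ m - n ∣
  ∣m⊖n∣≡∣m-n∣ zero    zero    = refl
  ∣m⊖n∣≡∣m-n∣ zero    (suc n) = refl
  ∣m⊖n∣≡∣m-n∣ (suc m) zero    = refl
  ∣m⊖n∣≡∣m-n∣ (suc m) (suc n) =
    trans (cong Data.Integer.∣_∣ ([1+m]⊖[1+n]≡m⊖n m n)) (∣m⊖n∣≡∣m-n∣ m n)

  ∣+m-+n∣≡∣m-n∣ : ∀ m n → Data.Integer.∣ + m - + n ∣ ≡ ℕ.∣ m - n ∣
  ∣+m-+n∣≡∣m-n∣ m n = trans (cong Data.Integer.∣_∣ (m-n≡m⊖n m n)) (∣m⊖n∣≡∣m-n∣ m n)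

  i+m≡i+n⇒m≡n : ∀ i {m n} → i + + m ≡ i + + n → m ≡ n
  i+m≡i+n⇒m≡n i {m} {n} eq = +-injective (begin
    + m               ≡⟨ cancel i (+ m) ⟨
    - i + (i + + m)   ≡⟨ cong (_+_ (- i)) eq ⟩
    - i + (i + + n)   ≡⟨ cancel i (+ n) ⟩
    + n               ∎)
    where
    cancel : ∀ i x → - i + (i + x) ≡ x
    cancel = solve-∀

  ∣-cancel-multiple : ∀ {k a} → + k ∣ᵤ + a → ∀ c b x → + k ∣ᵤ c + + a * x + + b → + k ∣ᵤ c + + b
  ∣-cancel-multiple {k} {a} k∣a c b x k∣c+ax+b = ∣⇒∣ᵤ {+ k} (subst (+ k ∣_) (identity c (+ a) x (+ b))
    (∣m∣n⇒∣m-n {m = c + + a * x + + b} (∣ᵤ⇒∣ {+ k} k∣c+ax+b) (∣n⇒∣m*n x (∣ᵤ⇒∣ {+ k} {+ a} k∣a))))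
    where
    identity : ∀ c a x b → c + a * x + b - x * a ≡ c + b
    identity = solve-∀

module _ where
  open import Data.Nat using (ℕ; _+_; _*_; _^_; _≤_; z≤n; s≤s; NonZero; ∣_-_∣)
  open import Data.Nat.Properties
  open import Data.Nat.Divisibility using (_∣_; divides; ∣-trans; 1∣_)
  open import Data.Nat.GCD
    using (gcd; GCD; gcd-GCD; GCD-*; gcd[m,n]∣m; gcd[m,n]∣n; gcd-greatest; gcd-assoc; gcd-comm; gcd-identityʳ; gcd-zeroʳ)
  open import Data.Nat.Coprimality using (GCD≡1⇒coprime)
  open import Data.Nat.Tactic.RingSolver using (solve-∀)
  open import Data.Fin using (zero; suc)
  open import Data.Integer as ℤ using (ℤ; +_)
  import Data.Integer.Properties as ℤ
  open import Data.Integer.Divisibility using () renaming (_∣_ to _∣ℤ_)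
  open import Data.Integer.Divisibility.Signed as Signed using (∣ᵤ⇒∣; ∣⇒∣ᵤ)
  open import Data.List.Relation.Unary.All as ListAll using ([]; _∷_) renaming (All to AllList)
  import Data.List.Relation.Unary.All.Properties as ListAllₚ
  import Data.List.Relation.Unary.Unique.Propositional.Properties as Unique
  open import Data.Vec as Vec using (Vec; []; _∷_)
  import Data.Vec.Properties as Vec
  open import Data.Vec.Relation.Unary.All as VecAll using (All; []; _∷_)
  import Data.Vec.Relation.Unary.All.Properties as VecAllₚ
  open import Data.Vec.Relation.Binary.Pointwise.Inductive using (Pointwise; []; _∷_)
  open import Relation.Nullary using (yes; no; ¬_; contradiction)

  IsInterval : List ℤ → ℕ → Set
  IsInterval r L = ∃ λ s → r ≡ intRange s L

  boxCount : ∀ {k} → ℕ → ℕ → Vec ℕ k → Vec (List ℤ) k → ℤ → ℕ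
  boxCount d b A R c = ∑ (λ x → 𝟙 (d ∣?ℤ (c ℤ.+ linVal b A x))) (box R)

  boxCount-∷ : ∀ {k} d b a (A : Vec ℕ k) r R c →
    boxCount d b (a ∷ A) (r ∷ R) c ≡ ∑ (λ x → boxCount d b A R (c ℤ.+ + a ℤ.* x)) r
  boxCount-∷ d b a A r R c = trans (∑-concatMap _ (λ x → map (x ∷_) (box R)) r) (∑-cong (λ x →
    trans (∑-map _ (x ∷_) (box R))
          (∑-cong (λ y → cong (λ z → 𝟙 (d ∣?ℤ z)) (sym (ℤ.+-assoc c (+ a ℤ.* x) (linVal b A y)))) (box R))) r)

  gcd[d,gcd[a,g]]∣a : ∀ d a g → gcd d (gcd a g) ∣ a
  gcd[d,gcd[a,g]]∣a d a g = ∣-trans (gcd[m,n]∣n d (gcd a g)) (gcd[m,n]∣m a g)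

  gcd[d,gcd[a,g]]∣gcd[d,g] : ∀ d a g → gcd d (gcd a g) ∣ gcd d g
  gcd[d,gcd[a,g]]∣gcd[d,g] d a g =
    gcd-greatest (gcd[m,n]∣m d (gcd a g)) (∣-trans (gcd[m,n]∣n d (gcd a g)) (gcd[m,n]∣n a g))

  gcd[a,gcd[d,g]]≡gcd[d,gcd[a,g]] : ∀ d a g → gcd a (gcd d g) ≡ gcd d (gcd a g)
  gcd[a,gcd[d,g]]≡gcd[d,gcd[a,g]] d a g =
    trans (sym (gcd-assoc a d g)) (trans (cong (λ x → gcd x g) (gcd-comm a d)) (gcd-assoc d a g))

  coprime-cofactors : ∀ {m n g a ρ} .{{_ : NonZero g}} → gcd m n ≡ g → m ≡ a * g → n ≡ ρ * g → Coprime a ρ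
  coprime-cofactors {g = g} {a} {ρ} gcd≡g refl refl =
    GCD≡1⇒coprime (GCD-* (subst (GCD (a * g) (ρ * g)) (trans gcd≡g (sym (*-identityˡ g))) (gcd-GCD (a * g) (ρ * g))))

  boxCount-≡0 : ∀ {k} d b (A : Vec ℕ k) R c → ¬ (+ gcd d (gcdV A) ∣ℤ (c ℤ.+ + b)) → boxCount d b A R c ≡ 0
  boxCount-≡0 d b []      []      c ¬h∣ with d ∣?ℤ (c ℤ.+ + b)
  ... | yes d∣ = contradiction (subst (_∣ ℤ.∣ c ℤ.+ + b ∣) (sym (gcd-identityʳ d)) d∣) ¬h∣
  ... | no _   = refl
  boxCount-≡0 d b (a ∷ A) (r ∷ R) c ¬h∣ =
    trans (boxCount-∷ d b a A r R c) (∑-zero (λ x → boxCount-≡0 d b A R (c ℤ.+ + a ℤ.* x) (¬h′∣ x)) r)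
    where
    ¬h′∣ : ∀ x → ¬ (+ gcd d (gcdV A) ∣ℤ (c ℤ.+ + a ℤ.* x ℤ.+ + b))
    ¬h′∣ x h′∣ = ¬h∣ (∣-cancel-multiple (gcd[d,gcd[a,g]]∣a d a (gcdV A)) c b x
                     (∣-trans (gcd[d,gcd[a,g]]∣gcd[d,g] d a (gcdV A)) h′∣))

  𝟙-∣-cong : ∀ {m n x y} → (+ m Signed.∣ x) ⇔ (+ n Signed.∣ y) → 𝟙 (m ∣?ℤ x) ≡ 𝟙 (n ∣?ℤ y)
  𝟙-∣-cong {m} {n} {x} {y} m∣x⇔n∣y = 𝟙-cong (m ∣?ℤ x) (n ∣?ℤ y)
    (λ m∣x → ∣⇒∣ᵤ {+ n} {y} (Equivalence.to m∣x⇔n∣y (∣ᵤ⇒∣ {+ m} {x} m∣x)))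
    (λ n∣y → ∣⇒∣ᵤ {+ m} {x} (Equivalence.from m∣x⇔n∣y (∣ᵤ⇒∣ {+ n} {y} n∣y)))

  first-coordinate-count : ∀ {h′ a ρ h a₁} .{{_ : NonZero ρ}} .{{_ : NonZero h}} →
    h′ ≡ ρ * h → a ≡ a₁ * h → Coprime a₁ ρ → ∀ {c b} → + h ∣ℤ (c ℤ.+ + b) → ∀ s L →
    ∃ λ t → ∑ (λ x → 𝟙 (h′ ∣?ℤ (c ℤ.+ + a ℤ.* x ℤ.+ + b))) (intRange s L) ≡ multiples ρ t L
  first-coordinate-count {h = h} refl refl cop {c} {b} h∣c+b s L =
    map₂ (λ divisibility⇔ → trans (∑-map _ (λ j → s ℤ.+ + j) (upTo L))
                                  (∑-cong (λ j → 𝟙-∣-cong (divisibility⇔ j)) (upTo L)))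
      (progression-divisibility cop {c} {b} (∣ᵤ⇒∣ {+ h} {c ℤ.+ + b} h∣c+b) s)

  layer-estimate : ∀ {X n ρ L P k e m} .{{_ : NonZero e}} →
    ∣ X * (e * m) - n * (P * m) ∣ ≤ n * (k * P * e) → ∣ n * ρ - L ∣ ≤ ρ → n ≤ L → m ≤ L →
    ∣ X * (ρ * e) * m - L * P * m ∣ ≤ suc k * (L * P) * (ρ * e)
  layer-estimate {X} {n} {ρ} {L} {P} {k} {e} {m} ∣Xem-nPm∣≤ ∣nρ-L∣≤ρ n≤L m≤L = begin
    ∣ X * (ρ * e) * m - L * P * m ∣
      ≤⟨ ∣-∣-triangle (X * (ρ * e) * m) (n * ρ * (P * m)) (L * P * m) ⟩
    ∣ X * (ρ * e) * m - n * ρ * (P * m) ∣ + ∣ n * ρ * (P * m) - L * P * m ∣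
      ≡⟨ cong₂ _+_ (trans (cong₂ ∣_-_∣ (e₁ X ρ e m) (e₂ n ρ P m)) (sym (*-distribˡ-∣-∣ ρ _ _)))
                   (trans (cong (∣ n * ρ * (P * m) -_∣) (*-assoc L P m)) (sym (*-distribʳ-∣-∣ (P * m) (n * ρ) L))) ⟩
    ρ * ∣ X * (e * m) - n * (P * m) ∣ + ∣ n * ρ - L ∣ * (P * m)
      ≤⟨ +-mono-≤ (*-monoʳ-≤ ρ ∣Xem-nPm∣≤) (*-monoˡ-≤ (P * m) ∣nρ-L∣≤ρ) ⟩
    ρ * (n * (k * P * e)) + ρ * (P * m)
      ≤⟨ +-mono-≤ (*-monoʳ-≤ ρ (*-monoˡ-≤ (k * P * e) n≤L))
                  (*-monoʳ-≤ ρ (*-monoʳ-≤ P (≤-trans m≤L (m≤m*n L e)))) ⟩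
    ρ * (L * (k * P * e)) + ρ * (P * (L * e))
      ≡⟨ e₃ ρ L k P e ⟩
    suc k * (L * P) * (ρ * e)
      ∎
    where
    open ≤-Reasoning
    e₁ : ∀ X ρ e m → X * (ρ * e) * m ≡ ρ * (X * (e * m))
    e₁ = solve-∀
    e₂ : ∀ n ρ P m → n * ρ * (P * m) ≡ ρ * (n * (P * m))
    e₂ = solve-∀
    e₃ : ∀ ρ L k P e → ρ * (L * (k * P * e)) + ρ * (P * (L * e)) ≡ suc k * (L * P) * (ρ * e)
    e₃ = solve-∀

  -- With e = d / gcd(d, A₁, …, A_k): boxCount ≈ (∏ Lᵢ) / e up to the relative error k e / m, multiplied out.
  boxCount-estimate : ∀ {k} d b (A : Vec ℕ k) {R} {Ls : Vec ℕ k} → Pointwise IsInterval R Ls →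
    ∀ {m} → All (m ≤_) Ls → ∀ {c e} .{{_ : NonZero d}} → gcd d (gcdV A) * e ≡ d → + gcd d (gcdV A) ∣ℤ (c ℤ.+ + b) →
    ∣ boxCount d b A R c * e * m - prodV Ls * m ∣ ≤ k * prodV Ls * e
  boxCount-estimate d b [] [] {m} [] {c} {e} he h∣c+b =
    ≤-reflexive (trans (cong₂ (λ n x → ∣ n * x * m - 1 * m ∣) count≡1 e≡1) (∣n-n∣≡0 (1 * m)))
    where
    count≡1 : boxCount d b [] [] c ≡ 1
    count≡1 = cong (_+ 0) (𝟙-yes (d ∣?ℤ (c ℤ.+ + b)) (subst (_∣ ℤ.∣ c ℤ.+ + b ∣) (gcd-identityʳ d) h∣c+b))
    e≡1 : e ≡ 1
    e≡1 = *-cancelˡ-≡ e 1 d (trans (cong (_* e) (sym (gcd-identityʳ d))) (trans he (sym (*-identityʳ d))))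
  boxCount-estimate {suc k} d b (a ∷ A) {r ∷ R} {L ∷ Ls} ((s , refl) ∷ intervals) {m} (m≤L ∷ m≤Ls) {c} {e} he h∣c+b
    with gcd[d,gcd[a,g]]∣gcd[d,g] d a (gcdV A) | gcd[d,gcd[a,g]]∣a d a (gcdV A) | gcd[m,n]∣m d (gcdV A)
  ... | divides ρ h′≡ρh | divides a₁ a≡a₁h | divides e′ d≡e′h′ =
    subst₂ (λ n x → ∣ n * x * m - L * P′ * m ∣ ≤ suc k * (L * P′) * x)
      (sym (boxCount-∷ d b a A (intRange s L) R c)) (sym e≡ρe′)
      (layer-estimate {∑ T (intRange s L)} {k = k}
        (subst (λ n → ∣ ∑ T (intRange s L) * (e′ * m) - n * (P′ * m) ∣ ≤ n * (k * P′ * e′)) I≡multiples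
               (∣∑*-∑*∣≤∑* T I (e′ * m) (P′ * m) (k * P′ * e′) per-point (intRange s L)))
        (∣multiples*ρ-L∣≤ρ ρ t L) (multiples≤L ρ t L) m≤L)
    where
    h = gcd d (gcd a (gcdV A))
    h′ = gcd d (gcdV A)
    P′ = prodV Ls
    d≡e′ρh : d ≡ e′ * (ρ * h)
    d≡e′ρh = trans d≡e′h′ (cong (e′ *_) h′≡ρh)
    instance
      h≢0 : NonZero h
      h≢0 = m*n≢0⇒m≢0 h {{subst NonZero (sym he) it}}
      e′≢0 : NonZero e′
      e′≢0 = m*n≢0⇒m≢0 e′ {{subst NonZero d≡e′h′ it}}
      ρ≢0 : NonZero ρ
      ρ≢0 = m*n≢0⇒m≢0 ρ {{m*n≢0⇒n≢0 e′ {{subst NonZero d≡e′ρh it}}}}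
    e≡ρe′ : e ≡ ρ * e′
    e≡ρe′ = m*n≡o*[p*m]⇒n≡p*o h {e} {e′} {ρ} (trans he d≡e′ρh)
    T : ℤ → ℕ
    T x = boxCount d b A R (c ℤ.+ + a ℤ.* x)
    I : ℤ → ℕ
    I x = 𝟙 (h′ ∣?ℤ (c ℤ.+ + a ℤ.* x ℤ.+ + b))
    first-coordinate : ∃ λ t → ∑ I (intRange s L) ≡ multiples ρ t L
    first-coordinate = first-coordinate-count {h′} {a} {ρ} {h} {a₁} h′≡ρh a≡a₁h
      (coprime-cofactors (gcd[a,gcd[d,g]]≡gcd[d,gcd[a,g]] d a (gcdV A)) a≡a₁h h′≡ρh) {c} {b} h∣c+b s L
    t = proj₁ first-coordinate
    I≡multiples = proj₂ first-coordinate
    per-point : ∀ x → ∣ T x * (e′ * m) - I x * (P′ * m) ∣ ≤ I x * (k * P′ * e′)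
    per-point x with h′ ∣?ℤ (c ℤ.+ + a ℤ.* x ℤ.+ + b)
    ... | yes h′∣ =
      subst₂ _≤_ (cong₂ ∣_-_∣ (*-assoc (T x) e′ m) (sym (*-identityˡ (P′ * m)))) (sym (*-identityˡ _))
        (boxCount-estimate d b A intervals m≤Ls {c ℤ.+ + a ℤ.* x} {e′} (trans (*-comm h′ e′) (sym d≡e′h′)) h′∣)
    ... | no h′∤ =
      ≤-reflexive (cong (λ n → ∣ n * (e′ * m) - 0 ∣) (boxCount-≡0 d b A R (c ℤ.+ + a ℤ.* x) h′∤))

  ∑𝟙-map-linVal : ∀ {k} d b (A : Vec ℕ k) R →
    ∑ (λ v → 𝟙 (d ∣?ℤ v)) (map (linVal b A) (box R)) ≡ boxCount d b A R (+ 0)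
  ∑𝟙-map-linVal d b A R = trans (∑-map _ (linVal b A) (box R))
    (∑-cong (λ x → cong (λ v → 𝟙 (d ∣?ℤ v)) (sym (ℤ.+-identityˡ (linVal b A x)))) (box R))

  countDiv≤boxCount : ∀ {k} d b (A : Vec ℕ k) R →
    countDiv d (List.deduplicate ℤ._≟_ (map (linVal b A) (box R))) ≤ boxCount d b A R (+ 0)
  countDiv≤boxCount d b A R = begin
    countDiv d (List.deduplicate ℤ._≟_ vs)   ≡⟨ length-filter≡∑𝟙 (d ∣?ℤ_) (List.deduplicate ℤ._≟_ vs) ⟩
    ∑ (λ v → 𝟙 (d ∣?ℤ v)) (List.deduplicate ℤ._≟_ vs) ≤⟨ ∑-deduplicate≤ ℤ._≟_ _ vs ⟩
    ∑ (λ v → 𝟙 (d ∣?ℤ v)) vs                 ≡⟨ ∑𝟙-map-linVal d b A R ⟩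
    boxCount d b A R (+ 0)                   ∎
    where
    open ≤-Reasoning
    vs = map (linVal b A) (box R)

  countDiv≡boxCount : ∀ {k} d b (A : Vec ℕ k) R → Unique (map (linVal b A) (box R)) →
    countDiv d (List.deduplicate ℤ._≟_ (map (linVal b A) (box R))) ≡ boxCount d b A R (+ 0)
  countDiv≡boxCount d b A R unique = begin
    countDiv d (List.deduplicate ℤ._≟_ vs)   ≡⟨ cong (countDiv d) (deduplicate-unique ℤ._≟_ unique) ⟩
    countDiv d vs                            ≡⟨ length-filter≡∑𝟙 (d ∣?ℤ_) vs ⟩
    ∑ (λ v → 𝟙 (d ∣?ℤ v)) vs                 ≡⟨ ∑𝟙-map-linVal d b A R ⟩
    boxCount d b A R (+ 0)                   ∎
    where
    open ≡-Reasoning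
    vs = map (linVal b A) (box R)

  box-∷ : ∀ {k} r (R : Vec (List ℤ) k) → box (r ∷ R) ≡ List.cartesianProductWith _∷_ r (box R)
  box-∷ []      R = refl
  box-∷ (x ∷ r) R = cong (map (x ∷_) (box R) List.++_) (box-∷ r R)

  box-unique : ∀ {k} {R : Vec (List ℤ) k} → All Unique R → Unique (box R)
  box-unique []                  = [] ∷ []
  box-unique {R = r ∷ R} (u ∷ us) = subst Unique (sym (box-∷ r R))
    (Unique.cartesianProductWith⁺ _∷_ Vec.∷-injective u (box-unique us))

  intRange-unique : ∀ s L → Unique (intRange s L)
  intRange-unique s L = Unique.map⁺ (i+m≡i+n⇒m≡n s) (Unique.upTo⁺ L)

  posRange-bounds : ∀ n → AllList (λ x → + 1 ℤ.≤ x × x ℤ.≤ + n) (posRange n)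
  posRange-bounds n = ListAllₚ.map⁺ (ListAllₚ.applyUpTo⁺₁ _ n (λ i<n → ℤ.+≤+ (s≤s z≤n) , ℤ.+≤+ i<n))

  box-inPosBox : ∀ {k} (N : Vec ℕ k) → AllList (InPosBox N) (box (Vec.map posRange N))
  box-inPosBox []      = (λ ()) ∷ []
  box-inPosBox (n ∷ N) = subst (AllList (InPosBox (n ∷ N))) (sym (box-∷ (posRange n) (Vec.map posRange N)))
    (ListAllₚ.cartesianProductWith⁺ (setoid ℤ) (setoid (Vec ℤ _)) _∷_ (posRange n) (box (Vec.map posRange N))
      λ x∈ xs∈ → λ where
        zero    → ListAll.lookup (posRange-bounds n) x∈
        (suc i) → ListAll.lookup (box-inPosBox N) xs∈ i)

  unique-map-injectiveOn : ∀ {A B : Set} {Q : A → Set} {f : A → B} →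
    (∀ {x y} → Q x → Q y → f x ≡ f y → x ≡ y) → ∀ {xs} → AllList Q xs → Unique xs → Unique (map f xs)
  unique-map-injectiveOn inj []       []          = []
  unique-map-injectiveOn inj (q ∷ qs) (x∉ ∷ uniq) =
    ListAllₚ.map⁺ (ListAll.zipWith (λ (x≢y , qy) fx≡fy → x≢y (inj q qy fx≡fy)) (x∉ , qs))
    ∷ unique-map-injectiveOn inj qs uniq

  Proper⁺⇒unique : ∀ {k} b (A N : Vec ℕ k) → Proper⁺ b A N → Unique (map (linVal b A) (box (Vec.map posRange N)))
  Proper⁺⇒unique b A N proper = unique-map-injectiveOn (proper _ _) (box-inPosBox N)
    (box-unique (VecAllₚ.map⁺ (VecAll.universal (intRange-unique (+ 1)) N)))

  posRange-intervals : ∀ {k} (N : Vec ℕ k) → Pointwise IsInterval (Vec.map posRange N) N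
  posRange-intervals []      = []
  posRange-intervals (n ∷ N) = (+ 1 , refl) ∷ posRange-intervals N

  symLength : ℕ → ℕ
  symLength n = suc (n + n)

  symRange-intervals : ∀ {k} (N : Vec ℕ k) → Pointwise IsInterval (Vec.map symRange N) (Vec.map symLength N)
  symRange-intervals []      = []
  symRange-intervals (n ∷ N) = (ℤ.- + n , refl) ∷ symRange-intervals N

  minV≤ : ∀ {k} (N : Vec ℕ k) → All (minV N ≤_) N
  minV≤ []           = []
  minV≤ (n ∷ [])     = ≤-refl ∷ []
  minV≤ (n ∷ n′ ∷ N) = m⊓n≤m n _ ∷ VecAll.map (≤-trans (m⊓n≤n n _)) (minV≤ (n′ ∷ N))

  prodV-symLength≤ : ∀ {k} (N : Vec ℕ k) → All (1 ≤_) N → prodV (Vec.map symLength N) ≤ 3 ^ k * prodV N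
  prodV-symLength≤ []      []         = ≤-refl
  prodV-symLength≤ {suc k} (n ∷ N) (1≤n ∷ 1≤N) = begin
    symLength n * prodV (Vec.map symLength N)   ≤⟨ *-mono-≤ symLength≤3n (prodV-symLength≤ N 1≤N) ⟩
    3 * n * (3 ^ k * prodV N)                   ≡⟨ regroup n (3 ^ k) (prodV N) ⟩
    3 * 3 ^ k * (n * prodV N)                   ∎
    where
    open ≤-Reasoning
    symLength≤3n : symLength n ≤ 3 * n
    symLength≤3n = subst (symLength n ≤_) (thrice n) (+-monoˡ-≤ (n + n) 1≤n)
      where
      thrice : ∀ n → n + (n + n) ≡ 3 * n
      thrice = solve-∀
    regroup : ∀ n a p → 3 * n * (a * p) ≡ 3 * a * (n * p)
    regroup = solve-∀

  gcd≡1⇒gcd*d≡d : ∀ {k} d (A : Vec ℕ k) → gcdV A ≡ 1 → gcd d (gcdV A) * d ≡ d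
  gcd≡1⇒gcd*d≡d d A gcd≡1 = trans (cong (λ g → gcd d g * d) gcd≡1) (trans (cong (_* d) (gcd-zeroʳ d)) (*-identityˡ d))

  gcd≡1⇒∣ : ∀ {k} d (A : Vec ℕ k) → gcdV A ≡ 1 → ∀ c → + gcd d (gcdV A) ∣ℤ c
  gcd≡1⇒∣ d A gcd≡1 c = subst (_∣ ℤ.∣ c ∣) (sym (trans (cong (gcd d) gcd≡1) (gcd-zeroʳ d))) (1∣ ℤ.∣ c ∣)

  countDiv-Pset≤ : ∀ {k} d b (A N : Vec ℕ k) .{{_ : NonZero d}} .{{_ : NonZero k}} → gcdV A ≡ 1 → All (1 ≤_) N →
    countDiv d (Pset b A N) * d * minV N ≤ 3 ^ k * k * prodV N * (minV N + d)
  countDiv-Pset≤ {k} d b A N gcd≡1 1≤N = begin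
    countDiv d (Pset b A N) * d * m                ≤⟨ *-monoˡ-≤ m (*-monoˡ-≤ d (countDiv≤boxCount d b A R)) ⟩
    boxCount d b A R (+ 0) * d * m                 ≤⟨ m≤n+∣m-n∣ _ (P * m) ⟩
    P * m + ∣ boxCount d b A R (+ 0) * d * m - P * m ∣
      ≤⟨ +-monoʳ-≤ (P * m) (boxCount-estimate d b A (symRange-intervals N) m≤symLength {+ 0}
                              (gcd≡1⇒gcd*d≡d d A gcd≡1) (gcd≡1⇒∣ d A gcd≡1 (+ 0 ℤ.+ + b))) ⟩
    P * m + k * P * d                              ≤⟨ +-monoˡ-≤ (k * P * d) (*-monoˡ-≤ m (m≤n*m P k)) ⟩
    k * P * m + k * P * d                          ≡⟨ *-distribˡ-+ (k * P) m d ⟨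
    k * P * (m + d)                                ≤⟨ *-monoˡ-≤ (m + d) (*-monoʳ-≤ k (prodV-symLength≤ N 1≤N)) ⟩
    k * (3 ^ k * prodV N) * (m + d)                ≡⟨ regroup k (3 ^ k) (prodV N) (m + d) ⟩
    3 ^ k * k * prodV N * (m + d)                  ∎
    where
    open ≤-Reasoning
    R = Vec.map symRange N
    P = prodV (Vec.map symLength N)
    m = minV N
    m≤symLength : All (m ≤_) (Vec.map symLength N)
    m≤symLength = VecAllₚ.map⁺ (VecAll.map (λ m≤n → ≤-trans m≤n (≤-trans (m≤m+n _ _) (n≤1+n _))) (minV≤ N))
    regroup : ∀ k a p q → k * (a * p) * q ≡ a * k * p * q
    regroup = solve-∀

  ∣countDiv-P⁺set-prodV∣≤ : ∀ {k} d b (A N : Vec ℕ k) .{{_ : NonZero d}} → gcdV A ≡ 1 → Proper⁺ b A N →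
    ∣ countDiv d (P⁺set b A N) * d * minV N - prodV N * minV N ∣ ≤ k * prodV N * d
  ∣countDiv-P⁺set-prodV∣≤ {k} d b A N gcd≡1 proper =
    subst (λ n → ∣ n * d * minV N - prodV N * minV N ∣ ≤ k * prodV N * d)
      (sym (countDiv≡boxCount d b A (Vec.map posRange N) (Proper⁺⇒unique b A N proper)))
      (boxCount-estimate d b A (posRange-intervals N) (minV≤ N) {+ 0}
        (gcd≡1⇒gcd*d≡d d A gcd≡1) (gcd≡1⇒∣ d A gcd≡1 (+ 0 ℤ.+ + b)))

open import Data.Nat using (ℕ; _≤_; _*_; _+_)
open import Data.Integer using (+_; ∣_∣; _-_)
open import Data.Vec using (Vec; lookup)
open import Data.Fin using (Fin)
open import Data.Nat.Properties using (*-monoˡ-≤; m≤n*m; m^n>0; module ≤-Reasoning)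
open import Data.Vec.Relation.Unary.All.Properties using (lookup⁻)

lemma2p15 : (k : ℕ) → 1 ≤ k → Σ ℕ λ C →
    ((d b : ℕ) (A N : Vec ℕ k) → 1 ≤ d → (∀ (i : Fin k) → 1 ≤ lookup A i) →
      (∀ (i : Fin k) → 1 ≤ lookup N i) → gcdV A ≡ 1 →
      countDiv d (Pset b A N) * d * minV N ≤ C * prodV N * (minV N + d))
    ×
    ((d b : ℕ) (A N : Vec ℕ k) → 1 ≤ d → (∀ (i : Fin k) → 1 ≤ lookup A i) →
      (∀ (i : Fin k) → 1 ≤ lookup N i) → gcdV A ≡ 1 → Proper⁺ b A N →
      ∣ + (countDiv d (P⁺set b A N) * d * minV N) - + (prodV N * minV N) ∣ ≤ C * prodV N * d)
lemma2p15 k 1≤k = 3 ℕ.^ k * k , part-i , part-ii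
  where
  instance
    k≢0 : ℕ.NonZero k
    k≢0 = ℕ.>-nonZero 1≤k
  part-i = λ d b A N 1≤d _ 1≤N gcd≡1 → countDiv-Pset≤ d b A N {{ℕ.>-nonZero 1≤d}} gcd≡1 (lookup⁻ 1≤N)
  part-ii = λ d b A N 1≤d _ _ gcd≡1 proper → let open ≤-Reasoning in begin
    ∣ + (countDiv d (P⁺set b A N) * d * minV N) - + (prodV N * minV N) ∣
      ≡⟨ ∣+m-+n∣≡∣m-n∣ (countDiv d (P⁺set b A N) * d * minV N) (prodV N * minV N) ⟩
    ℕ.∣ countDiv d (P⁺set b A N) * d * minV N - prodV N * minV N ∣
      ≤⟨ ∣countDiv-P⁺set-prodV∣≤ d b A N {{ℕ.>-nonZero 1≤d}} gcd≡1 proper ⟩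
    k * prodV N * d
      ≤⟨ *-monoˡ-≤ d (*-monoˡ-≤ (prodV N) (m≤n*m k (3 ℕ.^ k) {{ℕ.>-nonZero (m^n>0 3 k)}})) ⟩
    3 ℕ.^ k * k * prodV N * d
      ∎
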